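{- For every integer $k \geq 3$, the disjoint union $K_{1,8} + K_{1,9(k-1)-1}$ is equitably $k$-choosable.
   Context: A list assignment $L$ for a graph $G$ assigns to each vertex $v$ a set $L(v)$ of colors; it is a $k$-assignment if $|L(v)|=k$ for all $v$. The palette of $L$ is $\bigcup_{v} L(v)$. A proper $L$-coloring is a proper coloring $f$ with $f(v)\in L(v)$ for all $v$. If $L$ is a $k$-assignment, an equitable $L$-coloring of $G$ is a proper $L$-coloring in which each color of the palette appears on at most $\lceil |V(G)|/k \rceil$ vertices. $G$ is equitably $k$-choosable if an equitable $L$-coloring exists for every $k$-assignment $L$ for $G$. -}

module Defs where

open import Data.Nat using (ℕ; zero; suc; _+_; _*_; _∸_; _≤_)
open import Data.Nat.DivMod using (_/_)
open import Data.Fin using (Fin; zero; suc; splitAt)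
open import Data.List using (List; length; filter; allFin)
open import Data.List.Membership.Propositional using (_∈_)
open import Data.List.Relation.Unary.Unique.Propositional using (Unique)
open import Data.Sum using (_⊎_; inj₁; inj₂)
open import Data.Product using (_×_; Σ)
open import Data.Empty using (⊥)
open import Data.Unit using (⊤)
open import Relation.Binary.PropositionalEquality using (_≡_)
open import Relation.Nullary using (¬_)
open import Relation.Nullary.Decidable using (does)
import Data.Nat as ℕ

record Graph (n : ℕ) : Set₁ where
  field
    Adj     : Fin n → Fin n → Set
    sym     : ∀ {u v} → Adj u v → Adj v u
    irrefl  : ∀ {v} → ¬ Adj v v

open Graph public

-- Ceiling division ⌈ m / k ⌉ (for k ≥ 1; the value for k = 0 is irrelevant).
ceilDiv : ℕ → ℕ → ℕ
ceilDiv m zero    = m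
ceilDiv m (suc k) = (m + k) / suc k

-- Colours are natural numbers.  A k-assignment gives each vertex a list of
-- k pairwise distinct colours (i.e. a k-element set of colours).
IsKAssignment : ∀ {n} → ℕ → (Fin n → List ℕ) → Set
IsKAssignment {n} k L = (v : Fin n) → Unique (L v) × length (L v) ≡ k

IsProperLColoring : ∀ {n} → Graph n → (Fin n → List ℕ) → (Fin n → ℕ) → Set
IsProperLColoring {n} G L f =
  ((v : Fin n) → f v ∈ L v) × (∀ u v → Adj G u v → ¬ (f u ≡ f v))

colorCount : ∀ {n} → (Fin n → ℕ) → ℕ → ℕ
colorCount {n} f c = length (filter (λ v → f v ℕ.≟ c) (allFin n))

IsEquitableLColoring : ∀ {n} → Graph n → ℕ → (Fin n → List ℕ) → (Fin n → ℕ) → Set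
IsEquitableLColoring {n} G k L f =
  IsProperLColoring G L f × ((c : ℕ) → colorCount f c ≤ ceilDiv n k)

EquitablyChoosable : ∀ {n} → Graph n → ℕ → Set
EquitablyChoosable {n} G k =
  (L : Fin n → List ℕ) → IsKAssignment k L →
  Σ (Fin n → ℕ) (λ f → IsEquitableLColoring G k L f)

-- The star K_{1,a} on vertex set Fin (suc a); vertex zero is the centre.
starAdj : ∀ {a} → Fin (suc a) → Fin (suc a) → Set
starAdj zero    zero    = ⊥
starAdj zero    (suc _) = ⊤
starAdj (suc _) zero    = ⊤
starAdj (suc _) (suc _) = ⊥

Star : (a : ℕ) → Graph (suc a)
Star a = record { Adj = starAdj ; sym = s ; irrefl = i }
  where
  s : ∀ {u v : Fin (suc a)} → starAdj u v → starAdj v u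
  s {zero}  {suc _} p = p
  s {suc _} {zero}  p = p
  i : ∀ {v : Fin (suc a)} → ¬ starAdj v v
  i {zero} ()
  i {suc _} ()

-- Disjoint union G + H on Fin (m + n): first m vertices are G, rest are H.
unionAdj : ∀ {m n} → Graph m → Graph n → Fin (m + n) → Fin (m + n) → Set
unionAdj {m} G H u v with splitAt m u | splitAt m v
... | inj₁ x | inj₁ y = Adj G x y
... | inj₁ _ | inj₂ _ = ⊥
... | inj₂ _ | inj₁ _ = ⊥
... | inj₂ x | inj₂ y = Adj H x y

_⊕_ : ∀ {m n} → Graph m → Graph n → Graph (m + n)
_⊕_ {m} {n} G H = record { Adj = unionAdj G H ; sym = s ; irrefl = i }
  where
  s : ∀ {u v} → unionAdj G H u v → unionAdj G H v u
  s {u} {v} p with splitAt m u | splitAt m v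
  ... | inj₁ x | inj₁ y = sym G p
  ... | inj₂ x | inj₂ y = sym H p
  i : ∀ {v} → ¬ unionAdj G H v v
  i {v} p with splitAt m v
  ... | inj₁ x = irrefl G p
  ... | inj₂ x = irrefl H p

module Submission where

-- Write k = r + 1 and N = 9r − 1, so the graph has 9k vertices and an equitable colouring
-- may use each colour at most 9 times.  Fix colours α and β for the two centres; the leaves
-- must then be coloured from their lists, avoiding the colour of their centre, with every
-- colour used at most 9 times overall.  An augmenting argument shows that this succeeds
-- unless there is an obstruction: a set U of at most r colours such that the centres
-- coloured in U together with the leaves whose admissible colours all lie in U (the
-- trapped leaves) number more than 9r.  Counting then forces α, β ∉ U, at least 2 of the 8
-- small leaves and all but at most 6 of the big leaves to be trapped, and the list of every
-- trapped leaf to be exactly U plus its centre colour.  So two obstructions always share a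
-- trapped big leaf, and if they also share a trapped small leaf they come from the same
-- pair (α, β).  Trying three colours α for the small centre, each with two colours β for
-- the big centre, yields six obstructions whose sets of trapped small leaves are pairwise
-- disjoint and have at least 2 elements each, which 8 small leaves cannot accommodate.

open import Data.Bool using (Bool; true; false; T; _∧_; _∨_)
open import Data.Bool.Properties using (T-∧; T-∨)
open import Data.Empty using (⊥; ⊥-elim)
open import Data.Fin using (Fin; zero; suc; _↑ˡ_; _↑ʳ_; splitAt; join)
import Data.Fin.Properties as Fin
open import Data.Nat using (ℕ; zero; suc; _+_; _*_; _∸_; _≤_; _<_; z≤n; s≤s; _≟_; _≤?_)
open import Data.Nat.DivMod using (m*n/n≡m; /-monoˡ-≤)
open import Data.Nat.Properties
open import Algebra.Properties.CommutativeSemigroup +-commutativeSemigroup using (interchange; xy∙z≈zy∙x; x∙yz≈xz∙y)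
open import Data.List using (List; []; _∷_; length; filter; allFin; tabulate)
open import Data.List.Membership.Propositional using (_∈_; _∉_; find)
open import Data.List.Membership.Propositional.Properties using (∈-filter⁺; ∈-filter⁻)
open import Data.List.Membership.DecPropositional _≟_ using (_∈?_)
open import Data.List.Properties using (filter-notAll)
open import Data.List.Relation.Binary.Subset.DecPropositional _≟_ using (_⊆_; _⊆?_)
import Data.List.Relation.Unary.All as All
open import Data.List.Relation.Unary.AllPairs using (_∷_)
open import Data.List.Relation.Unary.Any as Any using (Any; here; there)
open import Data.List.Relation.Unary.Unique.Propositional using (Unique)
import Data.List.Relation.Unary.Unique.Propositional.Properties as Unique
open import Data.Product using (Σ; ∃; _×_; _,_; proj₁; proj₂)
open import Data.Sum as Sum using (_⊎_; inj₁; inj₂)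
import Data.Sum.Effectful.Left as Sumₗ
open import Data.Unit using (tt)
import Data.Vec.Functional as V
open import Data.Vec.Functional using (updateAt)
open import Data.Vec.Functional.Properties using (updateAt-updates; updateAt-minimal; lookup-++ˡ; lookup-++ʳ)
open import Effect.Monad using (RawMonad)
open import Function using (id; _∘_; const; Equivalence)
open import Level using (0ℓ)
open import Relation.Binary.PropositionalEquality
open import Relation.Nullary using (¬_; Dec; does; ¬?; yes; no)
open import Relation.Nullary.Decidable using (_×-dec_; dec-true; dec-false; decidable-stable)
open import Relation.Unary using (Pred; Decidable)

open import Defs hiding (sym)

⟦_⟧ : Bool → ℕ
⟦ true ⟧  = 1
⟦ false ⟧ = 0

count : ∀ {n} → (Fin n → Bool) → ℕ
count {zero}  p = 0
count {suc n} p = ⟦ p zero ⟧ + count (p ∘ suc)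

_∩_ _∪_ : ∀ {n} → (Fin n → Bool) → (Fin n → Bool) → Fin n → Bool
(p ∩ q) i = p i ∧ q i
(p ∪ q) i = p i ∨ q i

Disjoint : ∀ {n} → (Fin n → Bool) → (Fin n → Bool) → Set
Disjoint p q = ∀ i → T (p i) → T (q i) → ⊥

count≤n : ∀ {n} (p : Fin n → Bool) → count p ≤ n
count≤n {zero}  p = z≤n
count≤n {suc n} p = +-mono-≤ (⟦⟧≤1 (p zero)) (count≤n (p ∘ suc))
  where
  ⟦⟧≤1 : ∀ b → ⟦ b ⟧ ≤ 1
  ⟦⟧≤1 true  = s≤s z≤n
  ⟦⟧≤1 false = z≤n

count-cong : ∀ {n} {p q : Fin n → Bool} → (∀ i → p i ≡ q i) → count p ≡ count q
count-cong {zero}  eq = refl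
count-cong {suc n} eq = cong₂ _+_ (cong ⟦_⟧ (eq zero)) (count-cong (eq ∘ suc))

count-mono : ∀ {n} {p q : Fin n → Bool} → (∀ i → T (p i) → T (q i)) → count p ≤ count q
count-mono {zero}  p⊆q = z≤n
count-mono {suc n} {p} {q} p⊆q = +-mono-≤ (⟦⟧-mono (p zero) (q zero) (p⊆q zero)) (count-mono (p⊆q ∘ suc))
  where
  ⟦⟧-mono : ∀ a b → (T a → T b) → ⟦ a ⟧ ≤ ⟦ b ⟧
  ⟦⟧-mono true  true  _ = ≤-refl
  ⟦⟧-mono true  false f = ⊥-elim (f tt)
  ⟦⟧-mono false _     _ = z≤n

count-split : ∀ m {n} (p : Fin (m + n) → Bool) →
              count p ≡ count (p ∘ (_↑ˡ n)) + count (p ∘ (m ↑ʳ_))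
count-split zero    p = refl
count-split (suc m) p = trans (cong (⟦ p zero ⟧ +_) (count-split m (p ∘ suc)))
                              (sym (+-assoc ⟦ p zero ⟧ _ _))

count-empty : ∀ {n} {p : Fin n → Bool} → (∀ i → ¬ T (p i)) → count p ≡ 0
count-empty {n} {p} none = n≤0⇒n≡0 (subst (count p ≤_) (count-false n) (count-mono none))
  where
  count-false : ∀ n → count {n} (λ _ → false) ≡ 0
  count-false zero    = refl
  count-false (suc n) = count-false n

count-nonempty : ∀ {n} (p : Fin n → Bool) → 0 < count p → ∃ λ i → T (p i)
count-nonempty {suc n} p pos with p zero in eq
... | true  = zero , subst T (sym eq) tt
... | false = let i , t = count-nonempty (p ∘ suc) pos in suc i , t

count-∩-∪ : ∀ {n} (p q : Fin n → Bool) → count p + count q ≡ count (p ∩ q) + count (p ∪ q)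
count-∩-∪ {zero}  p q = refl
count-∩-∪ {suc n} p q = begin
  (⟦ p zero ⟧ + count (p ∘ suc)) + (⟦ q zero ⟧ + count (q ∘ suc))
    ≡⟨ interchange ⟦ p zero ⟧ _ _ _ ⟩
  (⟦ p zero ⟧ + ⟦ q zero ⟧) + (count (p ∘ suc) + count (q ∘ suc))
    ≡⟨ cong₂ _+_ (pointwise (p zero) (q zero)) (count-∩-∪ (p ∘ suc) (q ∘ suc)) ⟩
  (⟦ p zero ∧ q zero ⟧ + ⟦ p zero ∨ q zero ⟧) + (count ((p ∩ q) ∘ suc) + count ((p ∪ q) ∘ suc))
    ≡⟨ interchange ⟦ p zero ∧ q zero ⟧ _ _ _ ⟩
  count (p ∩ q) + count (p ∪ q) ∎
  where
  open ≡-Reasoning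
  pointwise : ∀ a b → ⟦ a ⟧ + ⟦ b ⟧ ≡ ⟦ a ∧ b ⟧ + ⟦ a ∨ b ⟧
  pointwise true  true  = refl
  pointwise true  false = refl
  pointwise false true  = refl
  pointwise false false = refl

count-∪ : ∀ {n} {p q : Fin n → Bool} → Disjoint p q → count (p ∪ q) ≡ count p + count q
count-∪ {p = p} {q} p#q = sym (trans (count-∩-∪ p q) (cong (_+ count (p ∪ q)) ∩-empty))
  where
  ∩-empty : count (p ∩ q) ≡ 0
  ∩-empty = count-empty (λ i t → let tp , tq = Equivalence.to T-∧ t in p#q i tp tq)

count-disjoint≤ : ∀ {n} {p q : Fin n → Bool} → Disjoint p q → count p + count q ≤ n
count-disjoint≤ {p = p} {q} p#q = subst (_≤ _) (count-∪ p#q) (count≤n (p ∪ q))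

count-disjoint₃ : ∀ {n} {p q s : Fin n → Bool} → Disjoint p q → Disjoint p s → Disjoint q s →
                  count p + count q + count s ≤ n
count-disjoint₃ {p = p} {q} {s} p#q p#s q#s = subst (λ k → k + _ ≤ _) (count-∪ p#q) (count-disjoint≤ p∪q#s)
  where
  p∪q#s : Disjoint (p ∪ q) s
  p∪q#s i t ts with Equivalence.to T-∨ t
  ... | inj₁ tp = p#s i tp ts
  ... | inj₂ tq = q#s i tq ts

count-overlap : ∀ {n} (p q : Fin n → Bool) → n < count p + count q → ∃ λ i → T (p i) × T (q i)
count-overlap {n} p q n<pq = let i , t = count-nonempty (p ∩ q) ∩-nonempty in i , Equivalence.to T-∧ t
  where
  ∩-nonempty : 0 < count (p ∩ q)
  ∩-nonempty = +-cancelʳ-< (count (p ∪ q)) 0 (count (p ∩ q)) (begin-strict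
    count (p ∪ q)               ≤⟨ count≤n (p ∪ q) ⟩
    n                           <⟨ n<pq ⟩
    count p + count q           ≡⟨ count-∩-∪ p q ⟩
    count (p ∩ q) + count (p ∪ q) ∎)
    where open ≤-Reasoning

length-filter-allFin : ∀ {n p} {P : Pred (Fin n) p} (P? : Decidable P) →
                       length (filter P? (allFin n)) ≡ count (does ∘ P?)
length-filter-allFin {n} P? = go id
  where
  go : ∀ {m} (h : Fin m → Fin n) → length (filter P? (tabulate h)) ≡ count (does ∘ P? ∘ h)
  go {zero}  h = refl
  go {suc m} h with does (P? (h zero))
  ... | true  = cong suc (go (h ∘ suc))
  ... | false = go (h ∘ suc)

infixl 6 _∖_

_∖_ : List ℕ → ℕ → List ℕ
xs ∖ x = filter (λ y → ¬? (y ≟ x)) xs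

∈-∖⁺ : ∀ {x y xs} → y ∈ xs → y ≢ x → y ∈ xs ∖ x
∈-∖⁺ {x} = ∈-filter⁺ (λ z → ¬? (z ≟ x))

∈-∖⁻ : ∀ xs {x y} → y ∈ xs ∖ x → y ∈ xs × y ≢ x
∈-∖⁻ xs {x} = ∈-filter⁻ (λ z → ¬? (z ≟ x))

length-∖-< : ∀ {x xs} → x ∈ xs → length (xs ∖ x) < length xs
length-∖-< {x} {xs} x∈xs = filter-notAll (λ z → ¬? (z ≟ x)) xs (Any.map (λ x≡z z≢x → z≢x (sym x≡z)) x∈xs)

⊆-∷-∖ : ∀ x xs → xs ⊆ x ∷ (xs ∖ x)
⊆-∷-∖ x xs {z} z∈xs with z ≟ x
... | yes z≡x = here z≡x
... | no  z≢x = there (∈-∖⁺ z∈xs z≢x)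

⊆⇒length≤ : ∀ {xs ys} → Unique xs → xs ⊆ ys → length xs ≤ length ys
⊆⇒length≤ {[]}     _            _     = z≤n
⊆⇒length≤ {x ∷ xs} {ys} (x∉xs ∷ xs!) x∷xs⊆ys =
  ≤-trans (s≤s (⊆⇒length≤ xs! xs⊆ys∖x)) (length-∖-< (x∷xs⊆ys (here refl)))
  where
  xs⊆ys∖x : xs ⊆ ys ∖ x
  xs⊆ys∖x z∈xs = ∈-∖⁺ (x∷xs⊆ys (there z∈xs)) (λ { refl → All.lookup x∉xs z∈xs refl })

module _ {r : ℕ} {L : List ℕ} (L-size : Unique L × length L ≡ suc r) where

  ⊈-shorter : ∀ {V} → length V ≤ r → ¬ (L ⊆ V)
  ⊈-shorter {V} |V|≤r L⊆V = 1+n≰n (begin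
    suc r    ≡⟨ sym (proj₂ L-size) ⟩
    length L ≤⟨ ⊆⇒length≤ (proj₁ L-size) L⊆V ⟩
    length V ≤⟨ |V|≤r ⟩
    r        ∎)
    where open ≤-Reasoning

  module _ {c : ℕ} {U : List ℕ} (|U|≤r : length U ≤ r) (L∖c⊆U : L ∖ c ⊆ U) where

    ∖⊆-∈ : c ∈ L
    ∖⊆-∈ = decidable-stable (c ∈? L) λ c∉L →
      ⊈-shorter |U|≤r (λ z∈L → L∖c⊆U (∈-∖⁺ z∈L (λ { refl → c∉L z∈L })))

    ∖⊆-⊇ : U ⊆ L ∖ c
    ∖⊆-⊇ {u} u∈U = decidable-stable (u ∈? L ∖ c) λ u∉L∖c →
      ⊈-shorter (≤-trans (length-∖-< u∈U) |U|≤r) (L⊆c∷U∖u u∉L∖c)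
      where
      L⊆c∷U∖u : u ∉ L ∖ c → L ⊆ c ∷ (U ∖ u)
      L⊆c∷U∖u u∉L∖c {z} z∈L with z ≟ c
      ... | yes z≡c = here z≡c
      ... | no  z≢c = there (∈-∖⁺ (L∖c⊆U z∈L∖c) (λ { refl → u∉L∖c z∈L∖c }))
        where z∈L∖c = ∈-∖⁺ z∈L z≢c

-- If a ≢ a′ then, by ∖⊆-∈ and ∖⊆-⊇, a ∈ P ∖ a′ ⊆ U′ ⊆ Q ∖ b′, so a ∈ Q ∖ b ⊆ U.
centre-determined : ∀ {r P Q U U′ a a′ b b′} →
  Unique P × length P ≡ suc r → Unique Q × length Q ≡ suc r → length U ≤ r → length U′ ≤ r →
  a ≢ b → a ∉ U → P ∖ a ⊆ U → P ∖ a′ ⊆ U′ → Q ∖ b ⊆ U → Q ∖ b′ ⊆ U′ → a ≡ a′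
centre-determined {Q = Q} P-size Q-size |U|≤r |U′|≤r a≢b a∉U P∖a⊆U P∖a′⊆U′ Q∖b⊆U Q∖b′⊆U′ =
  decidable-stable (_ ≟ _) λ a≢a′ →
    let a∈U′ = P∖a′⊆U′ (∈-∖⁺ (∖⊆-∈ P-size |U|≤r P∖a⊆U) a≢a′)
        a∈Q  = proj₁ (∈-∖⁻ Q (∖⊆-⊇ Q-size |U′|≤r Q∖b′⊆U′ a∈U′))
    in a∉U (Q∖b⊆U (∈-∖⁺ a∈Q a≢b))

does⇒ : ∀ {p} {P : Set p} (P? : Dec P) → T (does P?) → P
does⇒ (yes p) _ = p

⇒does : ∀ {p} {P : Set p} (P? : Dec P) → P → T (does P?)
⇒does (yes _) _  = tt
⇒does (no ¬p) p = ¬p p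

countColour : ∀ {n} → (Fin n → ℕ) → ℕ → ℕ
countColour f x = count (λ i → does (f i ≟ x))

countIn : ∀ {n} → (Fin n → ℕ) → List ℕ → ℕ
countIn f U = count (λ i → does (f i ∈? U))

countIn-∷ : ∀ {n} (f : Fin n → ℕ) {u U} → u ∉ U → countIn f (u ∷ U) ≡ countColour f u + countIn f U
countIn-∷ f {u} {U} u∉U = count-∪ {p = λ i → does (f i ≟ u)} {q = λ i → does (f i ∈? U)} λ i fi≡u fi∈U →
  u∉U (subst (_∈ U) (does⇒ (f i ≟ u) fi≡u) (does⇒ (f i ∈? U) fi∈U))

countColour+countIn≤ : ∀ {n} (f : Fin n → ℕ) {u U} → u ∉ U → countColour f u + countIn f U ≤ n
countColour+countIn≤ {n} f {u} {U} u∉U = subst (_≤ n) (countIn-∷ f u∉U) (count≤n (λ i → does (f i ∈? u ∷ U)))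

countIn-saturated : ∀ {m n t} (f : Fin m → ℕ) (g : Fin n → ℕ) {U} → Unique U →
                    (∀ {u} → u ∈ U → t ≤ countColour f u + countColour g u) →
                    t * length U ≤ countIn f U + countIn g U
countIn-saturated {t = t} f g {[]}    _            _         = ≤-trans (≤-reflexive (*-zeroʳ t)) z≤n
countIn-saturated {t = t} f g {u ∷ U} (u∉U ∷ U!) saturated = begin
  t * suc (length U)
    ≡⟨ *-suc t (length U) ⟩
  t + t * length U
    ≤⟨ +-mono-≤ (saturated (here refl)) (countIn-saturated f g U! (saturated ∘ there)) ⟩
  (countColour f u + countColour g u) + (countIn f U + countIn g U)
    ≡⟨ interchange (countColour f u) _ _ _ ⟩
  (countColour f u + countIn f U) + (countColour g u + countIn g U)
    ≡⟨ sym (cong₂ _+_ (countIn-∷ f u∉U′) (countIn-∷ g u∉U′)) ⟩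
  countIn f (u ∷ U) + countIn g (u ∷ U) ∎
  where
  open ≤-Reasoning
  u∉U′ : u ∉ U
  u∉U′ u∈U = All.lookup u∉U u∈U refl

countColour-updateAt : ∀ {n} (f : Fin n → ℕ) i e x →
  countColour (updateAt f i (const e)) x + ⟦ does (f i ≟ x) ⟧ ≡ countColour f x + ⟦ does (e ≟ x) ⟧
countColour-updateAt f zero    e x = xy∙z≈zy∙x ⟦ does (e ≟ x) ⟧ _ _
countColour-updateAt f (suc i) e x = begin
  (⟦ does (f zero ≟ x) ⟧ + countColour (updateAt (f ∘ suc) i (const e)) x) + ⟦ does (f (suc i) ≟ x) ⟧
    ≡⟨ +-assoc ⟦ does (f zero ≟ x) ⟧ _ _ ⟩
  ⟦ does (f zero ≟ x) ⟧ + (countColour (updateAt (f ∘ suc) i (const e)) x + ⟦ does (f (suc i) ≟ x) ⟧)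
    ≡⟨ cong (⟦ does (f zero ≟ x) ⟧ +_) (countColour-updateAt (f ∘ suc) i e x) ⟩
  ⟦ does (f zero ≟ x) ⟧ + (countColour (f ∘ suc) x + ⟦ does (e ≟ x) ⟧)
    ≡⟨ sym (+-assoc ⟦ does (f zero ≟ x) ⟧ _ _) ⟩
  countColour f x + ⟦ does (e ≟ x) ⟧ ∎
  where open ≡-Reasoning

trapped : ∀ {n} → (Fin n → List ℕ) → (Fin n → ℕ) → List ℕ → ℕ
trapped L c U = count (λ i → does (L i ∖ c i ⊆? U))

trapped-++ : ∀ {m n} (L₁ : Fin m → List ℕ) (L₂ : Fin n → List ℕ) (c₁ : Fin m → ℕ) (c₂ : Fin n → ℕ) U →
             trapped (L₁ V.++ L₂) (c₁ V.++ c₂) U ≡ trapped L₁ c₁ U + trapped L₂ c₂ U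
trapped-++ {m} L₁ L₂ c₁ c₂ U = trans (count-split m _) (cong₂ _+_
  (count-cong λ i → cong₂ (λ L c → does (L ∖ c ⊆? U)) (lookup-++ˡ L₁ L₂ i) (lookup-++ˡ c₁ c₂ i))
  (count-cong λ j → cong₂ (λ L c → does (L ∖ c ⊆? U)) (lookup-++ʳ L₁ L₂ j) (lookup-++ʳ c₁ c₂ j)))

-- What one star contributes to an obstruction: its trapped leaves and its centre.  No leaf
-- is trapped when the centre colour c lies in U, because ∖⊆-⊇ would put c into L ∖ c.
module _ {r n : ℕ} {Ls : Fin n → List ℕ} {c : ℕ} {U : List ℕ}
         (Ls-assign : IsKAssignment (suc r) Ls) (|U|≤r : length U ≤ r) where

  trapped-centre∈ : c ∈ U → trapped Ls (const c) U + ⟦ does (c ∈? U) ⟧ ≡ 1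
  trapped-centre∈ c∈U = cong₂ _+_ (count-empty none) (cong ⟦_⟧ (dec-true (c ∈? U) c∈U))
    where
    none : ∀ i → ¬ T (does (Ls i ∖ c ⊆? U))
    none i t = proj₂ (∈-∖⁻ (Ls i) (∖⊆-⊇ (Ls-assign i) |U|≤r (does⇒ (Ls i ∖ c ⊆? U) t) c∈U)) refl

  trapped-centre∉ : c ∉ U → trapped Ls (const c) U + ⟦ does (c ∈? U) ⟧ ≡ trapped Ls (const c) U
  trapped-centre∉ c∉U =
    trans (cong (λ b → trapped Ls (const c) U + ⟦ b ⟧) (dec-false (c ∈? U) c∉U)) (+-identityʳ _)

  trapped-centre≤ : 1 ≤ n → trapped Ls (const c) U + ⟦ does (c ∈? U) ⟧ ≤ n
  trapped-centre≤ 1≤n = by-cases (c ∈? U)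
    where
    by-cases : Dec (c ∈ U) → trapped Ls (const c) U + ⟦ does (c ∈? U) ⟧ ≤ n
    by-cases (yes c∈U) = subst (_≤ n) (sym (trapped-centre∈ c∈U)) 1≤n
    by-cases (no  c∉U) = subst (_≤ n) (sym (trapped-centre∉ c∉U)) (count≤n _)

private
  +⟦≟⟧≤ : ∀ {a t} u x → (u ≡ x → suc a ≤ t) → a ≤ t → a + ⟦ does (u ≟ x) ⟧ ≤ t
  +⟦≟⟧≤ {a} {t} u x same differ with u ≟ x
  ... | yes u≡x = subst (λ b → a + ⟦ b ⟧ ≤ t) (sym (dec-true (u ≟ x) u≡x))
                    (subst (_≤ t) (+-comm 1 a) (same u≡x))
  ... | no  u≢x = subst (λ b → a + ⟦ b ⟧ ≤ t) (sym (dec-false (u ≟ x) u≢x))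
                    (subst (_≤ t) (sym (+-identityʳ a)) differ)

  spare-capacity : ∀ {a b u v m n t r} → a + u ≤ m → b + v ≤ n → t * r ≤ u + v →
                   m + suc n ≤ t * suc r → a + b < t
  spare-capacity {a} {b} {u} {v} {m} {n} {t} {r} a+u≤m b+v≤n tr≤u+v room =
    +-cancelʳ-≤ (t * r) (suc (a + b)) t (begin
      suc (a + b) + t * r       ≤⟨ +-monoʳ-≤ (suc (a + b)) tr≤u+v ⟩
      suc ((a + b) + (u + v))   ≡⟨ cong suc (interchange a b u v) ⟩
      suc ((a + u) + (b + v))   ≤⟨ s≤s (+-mono-≤ a+u≤m b+v≤n) ⟩
      suc (m + n)               ≡⟨ sym (+-suc m n) ⟩
      m + suc n                 ≤⟨ room ⟩
      t * suc r                 ≡⟨ *-suc t r ⟩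
      t + t * r                 ∎)
    where open ≤-Reasoning

module Extension (r t : ℕ) where

  Completion : ∀ {m n} → (Fin m → ℕ) → (Fin n → List ℕ) → (Fin n → ℕ) → (Fin n → ℕ) → Set
  Completion base L c col =
    (∀ i → col i ∈ L i) × (∀ i → col i ≢ c i) × (∀ x → countColour base x + countColour col x ≤ t)

  -- U offers only t * r slots, yet more than t * r vertices must take a colour from U.
  Obstruction : ∀ {m n} → (Fin m → ℕ) → (Fin n → List ℕ) → (Fin n → ℕ) → Set
  Obstruction base L c = ∃ λ U → length U ≤ r × t * r < trapped L c U + countIn base U

  -- Vertex 0 takes an unsaturated colour of U = L₀ ∖ c₀ if there is one.  Otherwise all of
  -- U is saturated; a vertex coloured in U that admits a colour e ∉ U is recoloured with e
  -- and hands its colour to vertex 0 (e has room: the saturated colours of U already occupy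
  -- t * r of fewer than t * (r + 1) vertices).  If no such vertex exists, U is an obstruction.
  module ExtendOne {m n} {base : Fin m → ℕ} {L : Fin (suc n) → List ℕ} {c : Fin (suc n) → ℕ}
                   (L-assign : IsKAssignment (suc r) L) (room : m + suc n ≤ t * suc r)
                   {col : Fin n → ℕ} (col-ok : Completion base (L ∘ suc) (c ∘ suc) col) where

    U : List ℕ
    U = L zero ∖ c zero

    load : ℕ → ℕ
    load x = countColour base x + countColour col x

    Saturated : Set
    Saturated = ∀ {u} → u ∈ U → t ≤ load u

    saturated : ¬ Any (λ u → load u < t) U → Saturated
    saturated ¬free u∈U = ≮⇒≥ λ load<t → ¬free (Any.map (λ { refl → load<t }) u∈U)

    countIn-U-saturated : Saturated → t * length U ≤ countIn base U + countIn col U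
    countIn-U-saturated = countIn-saturated base col (Unique.filter⁺ _ (proj₁ (L-assign zero)))

    r≤|U| : r ≤ length U
    r≤|U| = ≤-pred (begin
      suc r               ≡⟨ sym (proj₂ (L-assign zero)) ⟩
      length (L zero)     ≤⟨ ⊆⇒length≤ (proj₁ (L-assign zero)) (⊆-∷-∖ (c zero) (L zero)) ⟩
      suc (length U)      ∎)
      where open ≤-Reasoning

    extend-with-unsaturated : ∀ {u} → u ∈ U → load u < t → Σ _ (Completion base L c)
    extend-with-unsaturated {u} u∈U load<t = u V.∷ col , mem , avoid , cap
      where
      mem : ∀ i → (u V.∷ col) i ∈ L i
      mem zero    = proj₁ (∈-∖⁻ (L zero) u∈U)
      mem (suc i) = proj₁ col-ok i
      avoid : ∀ i → (u V.∷ col) i ≢ c i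
      avoid zero    = proj₂ (∈-∖⁻ (L zero) u∈U)
      avoid (suc i) = proj₁ (proj₂ col-ok) i
      cap : ∀ x → countColour base x + countColour (u V.∷ col) x ≤ t
      cap x = subst (_≤ t) (sym (x∙yz≈xz∙y (countColour base x) ⟦ does (u ≟ x) ⟧ _))
                (+⟦≟⟧≤ u x (λ { refl → load<t }) (proj₂ (proj₂ col-ok) x))

    extend-by-recolouring : Saturated → ∀ {i e} → col i ∈ U → e ∈ L (suc i) ∖ c (suc i) → e ∉ U →
                            Σ _ (Completion base L c)
    extend-by-recolouring sat {i} {e} coli∈U e∈ e∉U = col i V.∷ col′ , mem , avoid , cap
      where
      col′ : Fin n → ℕ
      col′ = updateAt col i (const e)
      mem : ∀ j → (col i V.∷ col′) j ∈ L j
      mem zero = proj₁ (∈-∖⁻ (L zero) coli∈U)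
      mem (suc j) with j Fin.≟ i
      ... | yes refl = subst (_∈ L (suc j)) (sym (updateAt-updates j col)) (proj₁ (∈-∖⁻ (L (suc i)) e∈))
      ... | no  j≢i  = subst (_∈ L (suc j)) (sym (updateAt-minimal j i col j≢i)) (proj₁ col-ok j)
      avoid : ∀ j → (col i V.∷ col′) j ≢ c j
      avoid zero = proj₂ (∈-∖⁻ (L zero) coli∈U)
      avoid (suc j) with j Fin.≟ i
      ... | yes refl = subst (_≢ c (suc j)) (sym (updateAt-updates j col)) (proj₂ (∈-∖⁻ (L (suc i)) e∈))
      ... | no  j≢i  = subst (_≢ c (suc j)) (sym (updateAt-minimal j i col j≢i)) (proj₁ (proj₂ col-ok) j)
      load-e<t : load e < t
      load-e<t = spare-capacity {u = countIn base U} {v = countIn col U}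
                   (countColour+countIn≤ base e∉U) (countColour+countIn≤ col e∉U)
                   (≤-trans (*-monoʳ-≤ t r≤|U|) (countIn-U-saturated sat)) room
      cap′ : ∀ x → load x + ⟦ does (e ≟ x) ⟧ ≤ t
      cap′ x = +⟦≟⟧≤ e x (λ { refl → load-e<t }) (proj₂ (proj₂ col-ok) x)
      cap : ∀ x → countColour base x + countColour (col i V.∷ col′) x ≤ t
      cap x = subst (_≤ t) (sym (begin
        countColour base x + (⟦ does (col i ≟ x) ⟧ + countColour col′ x)
          ≡⟨ cong (countColour base x +_) (+-comm ⟦ does (col i ≟ x) ⟧ _) ⟩
        countColour base x + (countColour col′ x + ⟦ does (col i ≟ x) ⟧)
          ≡⟨ cong (countColour base x +_) (countColour-updateAt col i e x) ⟩
        countColour base x + (countColour col x + ⟦ does (e ≟ x) ⟧)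
          ≡⟨ sym (+-assoc (countColour base x) _ _) ⟩
        load x + ⟦ does (e ≟ x) ⟧ ∎)) (cap′ x)
        where open ≡-Reasoning

    Recolourable : Fin n → Set
    Recolourable i = col i ∈ U × Any (_∉ U) (L (suc i) ∖ c (suc i))

    recolourable? : ∀ i → Dec (Recolourable i)
    recolourable? i = (col i ∈? U) ×-dec Any.any? (λ e → ¬? (e ∈? U)) (L (suc i) ∖ c (suc i))

    stuck : ¬ ∃ Recolourable → ∀ i → col i ∈ U → L (suc i) ∖ c (suc i) ⊆ U
    stuck ¬rec i coli∈U {e} e∈ = decidable-stable (e ∈? U) λ e∉U →
      ¬rec (i , coli∈U , Any.map (λ { refl → e∉U }) e∈)

    obstruction : Saturated → (∀ i → col i ∈ U → L (suc i) ∖ c (suc i) ⊆ U) → c zero ∈ L zero →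
                  Obstruction base L c
    obstruction sat L∖c⊆U c∈L = U , |U|≤r , (begin-strict
      t * r                                         ≤⟨ ≤-trans (*-monoʳ-≤ t r≤|U|) (countIn-U-saturated sat) ⟩
      countIn base U + countIn col U                ≤⟨ +-monoʳ-≤ (countIn base U) (count-mono col∈U⇒trapped) ⟩
      countIn base U + trapped (L ∘ suc) (c ∘ suc) U ≡⟨ +-comm (countIn base U) _ ⟩
      trapped (L ∘ suc) (c ∘ suc) U + countIn base U <⟨ ≤-refl ⟩
      suc (trapped (L ∘ suc) (c ∘ suc) U) + countIn base U ≡⟨ cong (_+ countIn base U) (sym U-trapped) ⟩
      trapped L c U + countIn base U                ∎)
      where
      open ≤-Reasoning
      |U|≤r : length U ≤ r
      |U|≤r = ≤-pred (subst (length U <_) (proj₂ (L-assign zero)) (length-∖-< c∈L))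
      col∈U⇒trapped : ∀ i → T (does (col i ∈? U)) → T (does (L (suc i) ∖ c (suc i) ⊆? U))
      col∈U⇒trapped i coli∈U = ⇒does (_ ⊆? U) (L∖c⊆U i (does⇒ (col i ∈? U) coli∈U))
      U-trapped : trapped L c U ≡ suc (trapped (L ∘ suc) (c ∘ suc) U)
      U-trapped = cong (λ b → ⟦ b ⟧ + trapped (L ∘ suc) (c ∘ suc) U) (dec-true (U ⊆? U) id)

    ∉-absurd : Saturated → c zero ∉ L zero → ⊥
    ∉-absurd sat c∉L = <-irrefl refl (begin-strict
      t * suc r                      ≡⟨ cong (t *_) (sym (proj₂ (L-assign zero))) ⟩
      t * length (L zero)            ≤⟨ *-monoʳ-≤ t (⊆⇒length≤ (proj₁ (L-assign zero)) L⊆U) ⟩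
      t * length U                   ≤⟨ countIn-U-saturated sat ⟩
      countIn base U + countIn col U ≤⟨ +-mono-≤ (count≤n (λ i → does (base i ∈? U)))
                                                 (count≤n (λ i → does (col i ∈? U))) ⟩
      m + n                          <⟨ +-monoʳ-< m (n<1+n n) ⟩
      m + suc n                      ≤⟨ room ⟩
      t * suc r                      ∎)
      where
      open ≤-Reasoning
      L⊆U : L zero ⊆ U
      L⊆U z∈L = ∈-∖⁺ z∈L λ { refl → c∉L z∈L }

    extend-or-obstruct : Σ _ (Completion base L c) ⊎ Obstruction base L c
    extend-or-obstruct with Any.any? (λ u → suc (load u) ≤? t) U
    ... | yes free = let _ , u∈U , load<t = find free in inj₁ (extend-with-unsaturated u∈U load<t)
    ... | no ¬free with Fin.any? recolourable?
    ...   | yes (i , coli∈U , e-any) = let _ , e∈ , e∉U = find e-any in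
                                       inj₁ (extend-by-recolouring (saturated ¬free) coli∈U e∈ e∉U)
    ...   | no ¬rec with c zero ∈? L zero
    ...     | yes c∈L = inj₂ (obstruction (saturated ¬free) (stuck ¬rec) c∈L)
    ...     | no  c∉L = ⊥-elim (∉-absurd (saturated ¬free) c∉L)

  complete-or-obstruct : ∀ {m} n {base : Fin m → ℕ} {L : Fin n → List ℕ} {c : Fin n → ℕ} →
                         (∀ x → countColour base x ≤ t) → IsKAssignment (suc r) L → m + n ≤ t * suc r →
                         Σ _ (Completion base L c) ⊎ Obstruction base L c
  complete-or-obstruct zero base≤t _ _ =
    inj₁ ((λ ()) , (λ ()) , (λ ()) , λ x → subst (_≤ t) (sym (+-identityʳ _)) (base≤t x))
  complete-or-obstruct {m} (suc n) {base} {L} {c} base≤t L-assign room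
    with complete-or-obstruct n base≤t (L-assign ∘ suc) (≤-trans (+-monoʳ-≤ m (n≤1+n n)) room)
  ... | inj₁ (_ , col-ok)         = ExtendOne.extend-or-obstruct L-assign room col-ok
  ... | inj₂ (U , |U|≤r , bound) =
    inj₂ (U , |U|≤r , ≤-trans bound (+-monoˡ-≤ (countIn base U) (m≤n+m _ ⟦ does (L zero ∖ c zero ⊆? U) ⟧)))

split-elim : ∀ m {n} (P : Fin (m + n) → Set) → (∀ i → P (i ↑ˡ n)) → (∀ j → P (m ↑ʳ j)) → ∀ v → P v
split-elim m {n} P left right v = subst P (Fin.join-splitAt m n v) (by-cases (splitAt m v))
  where
  by-cases : (s : Fin m ⊎ Fin n) → P (join m n s)
  by-cases (inj₁ i) = left i
  by-cases (inj₂ j) = right j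

module TwoStars (a b : ℕ) (L : Fin (suc a + suc b) → List ℕ) where

  centre₁ centre₂ : Fin (suc a + suc b)
  centre₁ = zero ↑ˡ suc b
  centre₂ = suc a ↑ʳ zero

  centreList₁ centreList₂ : List ℕ
  centreList₁ = L centre₁
  centreList₂ = L centre₂

  leafList₁ : Fin a → List ℕ
  leafList₁ i = L (suc i ↑ˡ suc b)

  leafList₂ : Fin b → List ℕ
  leafList₂ j = L (suc a ↑ʳ suc j)

  centreOf : ℕ → ℕ → Fin (a + b) → ℕ
  centreOf α β = V.replicate a α V.++ V.replicate b β

  assemble : ℕ → ℕ → (Fin (a + b) → ℕ) → Fin (suc a + suc b) → ℕ
  assemble α β col = (α V.∷ V.take a col) V.++ (β V.∷ V.drop a col)

  module _ {α β : ℕ} {col : Fin (a + b) → ℕ} (α∈ : α ∈ centreList₁) (β∈ : β ∈ centreList₂)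
           (col∈ : ∀ i → col i ∈ (leafList₁ V.++ leafList₂) i) (col≢ : ∀ i → col i ≢ centreOf α β i) where

    assemble-proper : IsProperLColoring (Star a ⊕ Star b) L (assemble α β col)
    assemble-proper = split-elim (suc a) (λ v → assemble α β col v ∈ L v) mem₁ mem₂ , adj
      where
      mem₁ : ∀ i → assemble α β col (i ↑ˡ suc b) ∈ L (i ↑ˡ suc b)
      mem₁ zero    = α∈
      mem₁ (suc i) = subst (_∈ leafList₁ i) (sym (lookup-++ˡ (α V.∷ V.take a col) (β V.∷ V.drop a col) (suc i)))
                       (subst (col (i ↑ˡ b) ∈_) (lookup-++ˡ leafList₁ leafList₂ i) (col∈ (i ↑ˡ b)))
      mem₂ : ∀ j → assemble α β col (suc a ↑ʳ j) ∈ L (suc a ↑ʳ j)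
      mem₂ zero    = subst (_∈ centreList₂) (sym (lookup-++ʳ (α V.∷ V.take a col) (β V.∷ V.drop a col) zero)) β∈
      mem₂ (suc j) = subst (_∈ leafList₂ j) (sym (lookup-++ʳ (α V.∷ V.take a col) (β V.∷ V.drop a col) (suc j)))
                       (subst (col (a ↑ʳ j) ∈_) (lookup-++ʳ leafList₁ leafList₂ j) (col∈ (a ↑ʳ j)))
      avoid₁ : ∀ i → col (i ↑ˡ b) ≢ α
      avoid₁ i = subst (col (i ↑ˡ b) ≢_) (lookup-++ˡ (V.replicate a α) (V.replicate b β) i) (col≢ (i ↑ˡ b))
      avoid₂ : ∀ j → col (a ↑ʳ j) ≢ β
      avoid₂ j = subst (col (a ↑ʳ j) ≢_) (lookup-++ʳ (V.replicate a α) (V.replicate b β) j) (col≢ (a ↑ʳ j))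
      adj : ∀ u v → Adj (Star a ⊕ Star b) u v → assemble α β col u ≢ assemble α β col v
      adj u v uv with splitAt (suc a) u | splitAt (suc a) v
      ... | inj₁ zero    | inj₁ (suc i) = λ α≡ → avoid₁ i (sym α≡)
      ... | inj₁ (suc i) | inj₁ zero    = avoid₁ i
      ... | inj₂ zero    | inj₂ (suc j) = λ β≡ → avoid₂ j (sym β≡)
      ... | inj₂ (suc j) | inj₂ zero    = avoid₂ j

  colorCount-assemble : ∀ α β col x →
    colorCount (assemble α β col) x ≡ countColour (α V.∷ β V.∷ V.[]) x + countColour col x
  colorCount-assemble α β col x = begin
    colorCount (A V.++ B) x
      ≡⟨ length-filter-allFin (λ v → (A V.++ B) v ≟ x) ⟩
    countColour (A V.++ B) x
      ≡⟨ count-split (suc a) (λ v → does ((A V.++ B) v ≟ x)) ⟩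
    countColour (V.take (suc a) (A V.++ B)) x + countColour (V.drop (suc a) (A V.++ B)) x
      ≡⟨ cong₂ _+_ (count-cong λ i → cong (λ y → does (y ≟ x)) (lookup-++ˡ A B i))
                   (count-cong λ j → cong (λ y → does (y ≟ x)) (lookup-++ʳ A B j)) ⟩
    (⟦ does (α ≟ x) ⟧ + countColour (V.take a col) x) + (⟦ does (β ≟ x) ⟧ + countColour (V.drop a col) x)
      ≡⟨ interchange ⟦ does (α ≟ x) ⟧ _ _ _ ⟩
    (⟦ does (α ≟ x) ⟧ + ⟦ does (β ≟ x) ⟧) + (countColour (V.take a col) x + countColour (V.drop a col) x)
      ≡⟨ cong₂ _+_ (cong (⟦ does (α ≟ x) ⟧ +_) (sym (+-identityʳ _))) (sym (count-split a (λ i → does (col i ≟ x)))) ⟩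
    countColour (α V.∷ β V.∷ V.[]) x + countColour col x ∎
    where
    open ≡-Reasoning
    A : Fin (suc a) → ℕ
    A = α V.∷ V.take a col
    B : Fin (suc b) → ℕ
    B = β V.∷ V.drop a col

record Distinct₃ (xs : List ℕ) : Set where
  field
    x₁ x₂ x₃ : ℕ
    x₁∈      : x₁ ∈ xs
    x₂∈      : x₂ ∈ xs
    x₃∈      : x₃ ∈ xs
    x₁≢x₂    : x₁ ≢ x₂
    x₁≢x₃    : x₁ ≢ x₃
    x₂≢x₃    : x₂ ≢ x₃

distinct₃ : ∀ {xs} → Unique xs → 3 ≤ length xs → Distinct₃ xs
distinct₃ {_ ∷ []}         _ (s≤s ())
distinct₃ {_ ∷ _ ∷ []}     _ (s≤s (s≤s ()))
distinct₃ {x ∷ y ∷ z ∷ _} ((x≢y All.∷ x≢z All.∷ _) ∷ (y≢z All.∷ _) ∷ _) _ = record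
  { x₁∈ = here refl ; x₂∈ = there (here refl) ; x₃∈ = there (there (here refl))
  ; x₁≢x₂ = x≢y ; x₁≢x₃ = x≢z ; x₂≢x₃ = y≢z }

record DistinctPairAvoiding (xs : List ℕ) (a : ℕ) : Set where
  field
    y₁ y₂ : ℕ
    y₁∈   : y₁ ∈ xs
    y₂∈   : y₂ ∈ xs
    y₁≢y₂ : y₁ ≢ y₂
    a≢y₁  : a ≢ y₁
    a≢y₂  : a ≢ y₂

open Distinct₃
open DistinctPairAvoiding

pairAvoiding : ∀ {xs} → Distinct₃ xs → ∀ a → DistinctPairAvoiding xs a
pairAvoiding D a with a ≟ x₁ D | a ≟ x₂ D
... | yes refl | _        = record { y₁∈ = x₂∈ D ; y₂∈ = x₃∈ D ; y₁≢y₂ = x₂≢x₃ D ; a≢y₁ = x₁≢x₂ D ; a≢y₂ = x₁≢x₃ D }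
... | no a≢x₁  | yes refl = record { y₁∈ = x₁∈ D ; y₂∈ = x₃∈ D ; y₁≢y₂ = x₁≢x₃ D ; a≢y₁ = a≢x₁   ; a≢y₂ = x₂≢x₃ D }
... | no a≢x₁  | no a≢x₂  = record { y₁∈ = x₁∈ D ; y₂∈ = x₂∈ D ; y₁≢y₂ = x₁≢x₂ D ; a≢y₁ = a≢x₁   ; a≢y₂ = a≢x₂ }

module EquitableStars (r : ℕ) (2≤r : 2 ≤ r) where

  N : ℕ
  N = 9 * r ∸ 1

  18≤9r : 18 ≤ 9 * r
  18≤9r = *-monoʳ-≤ 9 2≤r

  1+N≡9r : suc N ≡ 9 * r
  1+N≡9r = trans (+-comm 1 N) (m∸n+n≡m (≤-trans (s≤s z≤n) 18≤9r))

  1≤N : 1 ≤ N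
  1≤N = ≤-pred (subst (2 ≤_) (sym 1+N≡9r) (≤-trans (m≤m+n 2 16) 18≤9r))

  open Extension r 9

  base : ℕ → ℕ → Fin 2 → ℕ
  base α β = α V.∷ β V.∷ V.[]

  base≤9 : ∀ α β x → countColour (base α β) x ≤ 9
  base≤9 α β x = ≤-trans (count≤n (λ i → does (base α β i ≟ x))) (s≤s (s≤s z≤n))

  room : 2 + (8 + N) ≤ 9 * suc r
  room = ≤-reflexive (trans (cong (9 +_) 1+N≡9r) (sym (*-suc 9 r)))

  nine≤ceil : 9 ≤ ceilDiv (9 + suc N) (suc r)
  nine≤ceil = subst (_≤ ceilDiv (9 + suc N) (suc r)) (m*n/n≡m 9 (suc r))
    (/-monoˡ-≤ (suc r) (≤-trans (≤-reflexive 9[1+r]≡) (m≤m+n (9 + suc N) r)))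
    where
    9[1+r]≡ : 9 * suc r ≡ 9 + suc N
    9[1+r]≡ = trans (*-suc 9 r) (cong (9 +_) (sym 1+N≡9r))

  module _ (L : Fin (9 + suc N) → List ℕ) (L-assign : IsKAssignment (suc r) L) where

    open TwoStars 8 N L

    Equitable : Set
    Equitable = Σ _ (IsEquitableLColoring (Star 8 ⊕ Star N) (suc r) L)

    leaf₁-assign : IsKAssignment (suc r) leafList₁
    leaf₁-assign i = L-assign (suc i ↑ˡ suc N)

    leaf₂-assign : IsKAssignment (suc r) leafList₂
    leaf₂-assign j = L-assign (9 ↑ʳ suc j)

    leaf-assign : IsKAssignment (suc r) (leafList₁ V.++ leafList₂)
    leaf-assign i with splitAt 8 i
    ... | inj₁ i₁ = leaf₁-assign i₁
    ... | inj₂ i₂ = leaf₂-assign i₂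

    completion⇒equitable : ∀ {α β col} → α ∈ centreList₁ → β ∈ centreList₂ →
                     Completion (base α β) (leafList₁ V.++ leafList₂) (centreOf α β) col → Equitable
    completion⇒equitable {α} {β} {col} α∈ β∈ (col∈ , col≢ , capacity) =
      assemble α β col , assemble-proper α∈ β∈ col∈ col≢ , equitable-count
      where
      equitable-count : ∀ x → colorCount (assemble α β col) x ≤ ceilDiv (9 + suc N) (suc r)
      equitable-count x = begin
        colorCount (assemble α β col) x                     ≡⟨ colorCount-assemble α β col x ⟩
        countColour (base α β) x + countColour col x        ≤⟨ capacity x ⟩
        9                                                   ≤⟨ nine≤ceil ⟩
        ceilDiv (9 + suc N) (suc r)                         ∎
        where open ≤-Reasoning

    colour-or-obstruct : ∀ {α β} → α ∈ centreList₁ → β ∈ centreList₂ →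
                         Equitable ⊎ Obstruction (base α β) (leafList₁ V.++ leafList₂) (centreOf α β)
    colour-or-obstruct {α} {β} α∈ β∈ =
      Sum.map₁ (completion⇒equitable α∈ β∈ ∘ proj₂)
               (complete-or-obstruct (8 + N) {base α β} {c = centreOf α β} (base≤9 α β) leaf-assign room)

    smallTrapped : ℕ → List ℕ → Fin 8 → Bool
    smallTrapped α U i = does (leafList₁ i ∖ α ⊆? U)

    bigTrapped : ℕ → List ℕ → Fin N → Bool
    bigTrapped β U j = does (leafList₂ j ∖ β ⊆? U)

    record BadPair (α β : ℕ) : Set where
      field
        U     : List ℕ
        |U|≤r : length U ≤ r
        α∉U   : α ∉ U
        β∉U   : β ∉ U
        mostBigTrapped  : 9 * r ≤ 7 + count (bigTrapped β U)
        twoSmallTrapped : 2 ≤ count (smallTrapped α U)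

    -- α ∈ U would leave at most 1 + N = 9r obstructed vertices, β ∈ U at most 8 + 1.
    obstruction⇒badPair : ∀ {α β} → Obstruction (base α β) (leafList₁ V.++ leafList₂) (centreOf α β) → BadPair α β
    obstruction⇒badPair {α} {β} (U , |U|≤r , bound) = by-cases (α ∈? U) (β ∈? U)
      where
      open ≤-Reasoning
      S₁ S₂ A B : ℕ
      S₁ = count (smallTrapped α U)
      S₂ = count (bigTrapped β U)
      A = S₁ + ⟦ does (α ∈? U) ⟧
      B = S₂ + ⟦ does (β ∈? U) ⟧
      total : 9 * r < A + B
      total = subst (9 * r <_) (trans (cong₂ _+_ (trapped-++ leafList₁ leafList₂ (const α) (const β) U)
                                                  (cong (⟦ does (α ∈? U) ⟧ +_) (+-identityʳ _)))
                                      (interchange S₁ S₂ _ _)) bound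
      side₁ : A ≤ 8
      side₁ = trapped-centre≤ leaf₁-assign |U|≤r (s≤s z≤n)
      side₂ : B ≤ N
      side₂ = trapped-centre≤ leaf₂-assign |U|≤r 1≤N
      by-cases : Dec (α ∈ U) → Dec (β ∈ U) → BadPair α β
      by-cases (yes α∈U) _ = ⊥-elim (<-irrefl refl (begin-strict
        9 * r  <⟨ total ⟩
        A + B  ≡⟨ cong (_+ B) (trapped-centre∈ leaf₁-assign |U|≤r α∈U) ⟩
        1 + B  ≤⟨ s≤s side₂ ⟩
        suc N  ≡⟨ 1+N≡9r ⟩
        9 * r  ∎))
      by-cases (no _) (yes β∈U) = ⊥-elim (<-irrefl refl (begin-strict
        9 * r  <⟨ total ⟩
        A + B  ≡⟨ cong (A +_) (trapped-centre∈ leaf₂-assign |U|≤r β∈U) ⟩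
        A + 1  ≤⟨ +-monoˡ-≤ 1 side₁ ⟩
        9      ≤⟨ *-monoʳ-≤ 9 (≤-trans (s≤s z≤n) 2≤r) ⟩
        9 * r  ∎))
      by-cases (no α∉U) (no β∉U) = record
        { U = U ; |U|≤r = |U|≤r ; α∉U = α∉U ; β∉U = β∉U
        ; mostBigTrapped  = ≤-pred (≤-trans S₁+S₂ (+-monoˡ-≤ S₂ (count≤n (smallTrapped α U))))
        ; twoSmallTrapped = +-cancelʳ-≤ N 2 S₁ (begin
            suc (suc N) ≡⟨ cong suc 1+N≡9r ⟩
            suc (9 * r) ≤⟨ S₁+S₂ ⟩
            S₁ + S₂     ≤⟨ +-monoʳ-≤ S₁ (count≤n (bigTrapped β U)) ⟩
            S₁ + N      ∎) }
        where
        S₁+S₂ : 9 * r < S₁ + S₂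
        S₁+S₂ = subst (9 * r <_) (cong₂ _+_ (trapped-centre∉ leaf₁-assign |U|≤r α∉U)
                                            (trapped-centre∉ leaf₂-assign |U|≤r β∉U)) total

    open BadPair

    -- Each pair traps all but at most 6 of the N big leaves, so the two share a trapped big leaf.
    shared-smallTrapped⇒same-pair : ∀ {α β α′ β′} → α ≢ β → (C : BadPair α β) (C′ : BadPair α′ β′) →
      ∀ i → T (smallTrapped α (U C) i) → T (smallTrapped α′ (U C′) i) → α ≡ α′ × β ≡ β′
    shared-smallTrapped⇒same-pair {α} {β} {α′} {β′} α≢β C C′ i tC tC′ =
        centre-determined (leaf₁-assign i) (leaf₂-assign j) (|U|≤r C) (|U|≤r C′) α≢β       (α∉U C) P P′ Q Q′
      , centre-determined (leaf₂-assign j) (leaf₁-assign i) (|U|≤r C) (|U|≤r C′) (α≢β ∘ sym) (β∉U C) Q Q′ P P′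
      where
      S₂ S₂′ : ℕ
      S₂  = count (bigTrapped β (U C))
      S₂′ = count (bigTrapped β′ (U C′))
      N<S₂+S₂′ : N < S₂ + S₂′
      N<S₂+S₂′ = +-cancelʳ-≤ 14 (suc N) (S₂ + S₂′) (begin
        suc N + 14              ≡⟨ cong (_+ 14) 1+N≡9r ⟩
        9 * r + 14              ≤⟨ +-monoʳ-≤ (9 * r) (≤-trans (m≤m+n 14 4) 18≤9r) ⟩
        9 * r + 9 * r           ≤⟨ +-mono-≤ (mostBigTrapped C) (mostBigTrapped C′) ⟩
        (7 + S₂) + (7 + S₂′)    ≡⟨ interchange 7 S₂ 7 S₂′ ⟩
        14 + (S₂ + S₂′)         ≡⟨ +-comm 14 (S₂ + S₂′) ⟩
        S₂ + S₂′ + 14           ∎)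
        where open ≤-Reasoning
      shared : ∃ λ j → T (bigTrapped β (U C) j) × T (bigTrapped β′ (U C′) j)
      shared = count-overlap (bigTrapped β (U C)) (bigTrapped β′ (U C′)) N<S₂+S₂′
      j : Fin N
      j = proj₁ shared
      P  = does⇒ (leafList₁ i ∖ α ⊆? U C) tC
      P′ = does⇒ (leafList₁ i ∖ α′ ⊆? U C′) tC′
      Q  = does⇒ (leafList₂ j ∖ β ⊆? U C) (proj₁ (proj₂ shared))
      Q′ = does⇒ (leafList₂ j ∖ β′ ⊆? U C′) (proj₂ (proj₂ shared))

    record Blocked (α : ℕ) : Set where
      field
        β₁ β₂ : ℕ
        α≢β₁  : α ≢ β₁
        α≢β₂  : α ≢ β₂
        β₁≢β₂ : β₁ ≢ β₂
        bad₁  : BadPair α β₁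
        bad₂  : BadPair α β₂

      blockedTrapped : Fin 8 → Bool
      blockedTrapped = smallTrapped α (U bad₁) ∪ smallTrapped α (U bad₂)

      four≤blockedTrapped : 4 ≤ count blockedTrapped
      four≤blockedTrapped = subst (4 ≤_)
        (sym (count-∪ λ i t t′ → β₁≢β₂ (proj₂ (shared-smallTrapped⇒same-pair α≢β₁ bad₁ bad₂ i t t′))))
        (+-mono-≤ (twoSmallTrapped bad₁) (twoSmallTrapped bad₂))

      blockedTrapped⇒badPair : ∀ i → T (blockedTrapped i) →
                               ∃ λ β → α ≢ β × Σ (BadPair α β) λ C → T (smallTrapped α (U C) i)
      blockedTrapped⇒badPair i t with Equivalence.to T-∨ t
      ... | inj₁ t₁ = β₁ , α≢β₁ , bad₁ , t₁
      ... | inj₂ t₂ = β₂ , α≢β₂ , bad₂ , t₂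

    open Blocked using (blockedTrapped; four≤blockedTrapped; blockedTrapped⇒badPair)

    blockedTrapped-disjoint : ∀ {α α′} → α ≢ α′ → (B : Blocked α) (B′ : Blocked α′) →
                              Disjoint (blockedTrapped B) (blockedTrapped B′)
    blockedTrapped-disjoint α≢α′ B B′ i t t′ =
      let _ , α≢β , C  , tC  = blockedTrapped⇒badPair B  i t
          _ , _   , C′ , tC′ = blockedTrapped⇒badPair B′ i t′
      in α≢α′ (proj₁ (shared-smallTrapped⇒same-pair α≢β C C′ i tC tC′))

    ¬three-blocked : ∀ {α₁ α₂ α₃} → α₁ ≢ α₂ → α₁ ≢ α₃ → α₂ ≢ α₃ →
                     Blocked α₁ → Blocked α₂ → Blocked α₃ → ⊥
    ¬three-blocked α₁≢α₂ α₁≢α₃ α₂≢α₃ B₁ B₂ B₃ = 1+n≰n (begin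
      9                 ≤⟨ m≤m+n 9 3 ⟩
      4 + 4 + 4         ≤⟨ +-mono-≤ (+-mono-≤ (four≤blockedTrapped B₁) (four≤blockedTrapped B₂))
                                    (four≤blockedTrapped B₃) ⟩
      count (blockedTrapped B₁) + count (blockedTrapped B₂) + count (blockedTrapped B₃)
                        ≤⟨ count-disjoint₃ (blockedTrapped-disjoint α₁≢α₂ B₁ B₂)
                                           (blockedTrapped-disjoint α₁≢α₃ B₁ B₃)
                                           (blockedTrapped-disjoint α₂≢α₃ B₂ B₃) ⟩
      8                 ∎)
      where open ≤-Reasoning

    centre-distinct : ∀ v → Distinct₃ (L v)
    centre-distinct v = distinct₃ (proj₁ (L-assign v)) (subst (3 ≤_) (sym (proj₂ (L-assign v))) (s≤s 2≤r))

    -- In the left-biased monad on Equitable ⊎ _, the first colouring found is returned.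
    equitable-or-blocked : ∀ {α} → α ∈ centreList₁ → Equitable ⊎ Blocked α
    equitable-or-blocked {α} α∈ = do
      o₁ ← colour-or-obstruct α∈ (y₁∈ P)
      o₂ ← colour-or-obstruct α∈ (y₂∈ P)
      pure (record { α≢β₁ = a≢y₁ P ; α≢β₂ = a≢y₂ P ; β₁≢β₂ = y₁≢y₂ P
                   ; bad₁ = obstruction⇒badPair o₁ ; bad₂ = obstruction⇒badPair o₂ })
      where
      open RawMonad (Sumₗ.monad Equitable 0ℓ)
      P : DistinctPairAvoiding centreList₂ α
      P = pairAvoiding (centre-distinct centre₂) α

    equitable : Equitable
    equitable = Sum.fromInj₁ ⊥-elim do
      B₁ ← equitable-or-blocked (x₁∈ D)
      B₂ ← equitable-or-blocked (x₂∈ D)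
      B₃ ← equitable-or-blocked (x₃∈ D)
      pure (¬three-blocked (x₁≢x₂ D) (x₁≢x₃ D) (x₂≢x₃ D) B₁ B₂ B₃)
      where
      open RawMonad (Sumₗ.monad Equitable 0ℓ)
      D : Distinct₃ centreList₁
      D = centre-distinct centre₁

proposition4p7 : (k : ℕ) → 3 ≤ k → EquitablyChoosable (Star 8 ⊕ Star (9 * (k ∸ 1) ∸ 1)) k
proposition4p7 (suc r) (s≤s 2≤r) = EquitableStars.equitable r 2≤r
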